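{- Let $p$ be a prime with $p\equiv 1\pmod 3$, $\mathcal{R}=\mathbb{F}_p+u\mathbb{F}_p+u^2\mathbb{F}_p+u^3\mathbb{F}_p$ with $u^4=u$, and $\xi\in\mathbb{F}_p$ a primitive cube root of unity. Let $\Psi:\mathcal{R}\to\mathbb{F}_p^4$ be $$\Psi(a+bu+cu^2+du^3)=(a,\ a+b+c+d,\ a+b\xi^2+c\xi+d,\ a+b\xi+c\xi^2+d),$$ extended componentwise to $\Psi:\mathcal{R}^n\to\mathbb{F}_p^{4n}$. Then $\Psi$ is an $\mathbb{F}_p$-linear bijection; if $\mathcal{C}$ is a self-dual code over $\mathcal{R}$ then $\Psi(\mathcal{C})$ is a self-dual code in $\mathbb{F}_p^{4n}$; and $\Psi$ is distance preserving from $(\mathcal{R}^n,d_{G_\Psi})$ to $(\mathbb{F}_p^{4n},$ Hamming distance$)$.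
   Context: For $r\in\mathcal{R}^n$ the Gray weight is $w_{G_\Psi}(r)=w_H(\Psi(r))$ (Hamming weight) and the Gray distance is $d_{G_\Psi}(r,s)=w_{G_\Psi}(r-s)$. Codes over $\mathcal{R}$ are $\mathcal{R}$-submodules of $\mathcal{R}^n$; self-dual means $C=C^\perp$ with respect to the Euclidean inner product (over $\mathcal{R}$, resp. $\mathbb{F}_p$). -}

module Defs where

open import Data.Nat using (ℕ; zero; suc; _+_; _*_; _∸_; NonZero)
open import Data.Nat.DivMod using (_mod_)
open import Data.Fin using (Fin; toℕ)
open import Data.Fin.Properties using (_≟_)
open import Data.Vec using (Vec; []; _∷_; map; zipWith; concat; foldr′; replicate)
open import Data.Product using (_×_; ∃)
open import Relation.Binary.PropositionalEquality using (_≡_)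
open import Relation.Nullary using (¬_; does)
open import Data.Bool using (if_then_else_)

module Fp (p : ℕ) .{{_ : NonZero p}} where

  F : Set
  F = Fin p

  0F 1F : F
  0F = 0 mod p
  1F = 1 mod p

  infixl 6 _+F_ _-F_
  infixl 7 _*F_

  _+F_ _*F_ _-F_ : F → F → F
  x +F y = (toℕ x + toℕ y) mod p
  x *F y = (toℕ x * toℕ y) mod p
  x -F y = (toℕ x + (p ∸ toℕ y)) mod p

  PrimitiveCubeRoot : F → Set
  PrimitiveCubeRoot ξ = (ξ *F ξ *F ξ ≡ 1F) × ¬ (ξ ≡ 1F)

  -- The ring R = F_p + u F_p + u^2 F_p + u^3 F_p with u^4 = u;
  -- ⟨ a , b , c , d ⟩ stands for a + b u + c u^2 + d u^3.
  record R : Set where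
    constructor ⟨_,_,_,_⟩
    field
      a b c d : F

  0R : R
  0R = ⟨ 0F , 0F , 0F , 0F ⟩

  infixl 6 _+R_ _-R_
  infixl 7 _*R_

  _+R_ _-R_ : R → R → R
  ⟨ a , b , c , d ⟩ +R ⟨ a' , b' , c' , d' ⟩ = ⟨ a +F a' , b +F b' , c +F c' , d +F d' ⟩
  ⟨ a , b , c , d ⟩ -R ⟨ a' , b' , c' , d' ⟩ = ⟨ a -F a' , b -F b' , c -F c' , d -F d' ⟩

  -- multiplication using u^4 = u, u^5 = u^2, u^6 = u^3
  _*R_ : R → R → R
  ⟨ a0 , a1 , a2 , a3 ⟩ *R ⟨ b0 , b1 , b2 , b3 ⟩ =
    ⟨ a0 *F b0
    , a0 *F b1 +F a1 *F b0 +F a1 *F b3 +F a2 *F b2 +F a3 *F b1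
    , a0 *F b2 +F a1 *F b1 +F a2 *F b0 +F a2 *F b3 +F a3 *F b2
    , a0 *F b3 +F a1 *F b2 +F a2 *F b1 +F a3 *F b0 +F a3 *F b3 ⟩

  _·R_ : F → R → R
  k ·R ⟨ a , b , c , d ⟩ = ⟨ k *F a , k *F b , k *F c , k *F d ⟩

  _+Rⁿ_ _-Rⁿ_ : ∀ {n} → Vec R n → Vec R n → Vec R n
  x +Rⁿ y = zipWith _+R_ x y
  x -Rⁿ y = zipWith _-R_ x y

  _·Rⁿ_ : ∀ {n} → F → Vec R n → Vec R n
  k ·Rⁿ x = map (k ·R_) x

  _*Rⁿ_ : ∀ {n} → R → Vec R n → Vec R n
  r *Rⁿ x = map (r *R_) x

  _+Fⁿ_ : ∀ {m} → Vec F m → Vec F m → Vec F m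
  x +Fⁿ y = zipWith _+F_ x y

  _·Fⁿ_ : ∀ {m} → F → Vec F m → Vec F m
  k ·Fⁿ x = map (k *F_) x

  dotR : ∀ {n} → Vec R n → Vec R n → R
  dotR x y = foldr′ _+R_ 0R (zipWith _*R_ x y)

  dotF : ∀ {m} → Vec F m → Vec F m → F
  dotF x y = foldr′ _+F_ 0F (zipWith _*F_ x y)

  IsRCode : ∀ {n} → (Vec R n → Set) → Set
  IsRCode {n} C = C (replicate n 0R)
                × (∀ x y → C x → C y → C (x +Rⁿ y))
                × (∀ r x → C x → C (r *Rⁿ x))

  DualR : ∀ {n} → (Vec R n → Set) → Vec R n → Set
  DualR C x = ∀ y → C y → dotR x y ≡ 0R

  IsSelfDualR : ∀ {n} → (Vec R n → Set) → Set
  IsSelfDualR C = IsRCode C × (∀ x → (C x → DualR C x) × (DualR C x → C x))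

  IsFCode : ∀ {m} → (Vec F m → Set) → Set
  IsFCode {m} C = C (replicate m 0F)
                × (∀ x y → C x → C y → C (x +Fⁿ y))
                × (∀ k x → C x → C (k ·Fⁿ x))

  DualF : ∀ {m} → (Vec F m → Set) → Vec F m → Set
  DualF C x = ∀ y → C y → dotF x y ≡ 0F

  IsSelfDualF : ∀ {m} → (Vec F m → Set) → Set
  IsSelfDualF C = IsFCode C × (∀ x → (C x → DualF C x) × (DualF C x → C x))

  hammingWeight : ∀ {m} → Vec F m → ℕ
  hammingWeight [] = 0
  hammingWeight (a ∷ x) = if does (a ≟ 0F) then hammingWeight x else suc (hammingWeight x)

  hammingDist : ∀ {m} → Vec F m → Vec F m → ℕ
  hammingDist [] [] = 0
  hammingDist (a ∷ x) (b ∷ y) = if does (a ≟ b) then hammingDist x y else suc (hammingDist x y)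

  module Gray (ξ : F) where

    Ψ₁ : R → Vec F 4
    Ψ₁ ⟨ a , b , c , d ⟩ =
      a ∷ (a +F b +F c +F d)
        ∷ (a +F b *F (ξ *F ξ) +F c *F ξ +F d)
        ∷ (a +F b *F ξ +F c *F (ξ *F ξ) +F d) ∷ []

    Ψ : ∀ {n} → Vec R n → Vec F (n * 4)
    Ψ x = concat (map Ψ₁ x)

    grayWeight : ∀ {n} → Vec R n → ℕ
    grayWeight x = hammingWeight (Ψ x)

    grayDist : ∀ {n} → Vec R n → Vec R n → ℕ
    grayDist x y = grayWeight (x -Rⁿ y)

    image : ∀ {n} → (Vec R n → Set) → Vec F (n * 4) → Set
    image C y = ∃ λ x → C x × Ψ x ≡ y

module Submission where

-- Since u⁴ = u, the ring R = F_p[u]/(u⁴ − u) is evaluated at the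
-- four roots 0, 1, ξ², ξ of X⁴ − X, and Ψ₁ r = (r(0), r(1), r(ξ²), r(ξ)) lists
-- exactly these values.  Evaluation at a root of X⁴ − X is a ring homomorphism,
-- so Ψ₁ : R → F_p⁴ is an F_p-linear ring homomorphism; on the coordinates of
-- u, u², u³ it is a 3-point discrete Fourier transform over the cube roots of
-- unity, which 1 + ξ + ξ² = 0 and the invertibility of 3 allow us to invert.

open import Defs
open import Data.Nat using (ℕ; NonZero; _%_; _*_; zero; suc; _+_; _∸_; _/_)
open import Data.Nat.Base using (>-nonZero⁻¹)
import Data.Nat.Properties as ℕ
open import Data.Nat.DivMod using (_mod_; m%n<n; m<n⇒m%n≡m; %-distribˡ-+; %-distribˡ-*; [m+n]%n≡m%n; [m+kn]%n≡m%n; m≡m%n+[m/n]*n)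
open import Data.Nat.Divisibility using (_∣_; m%n≡0⇒n∣m; n∣m⇒m%n≡0)
open import Data.Nat.Primality using (Prime; euclidsLemma)
import Data.Nat.Solver as ℕ-Solver
open import Data.Fin using (toℕ)
open import Data.Fin.Properties using (toℕ-fromℕ<; toℕ-injective; toℕ<n; _≟_)
open import Data.Vec using (Vec; []; _∷_; _++_; zipWith; map; replicate)
open import Data.Vec.Properties using (map-∘; map-cong; map-id; map-++; zipWith-++; ++-injective)
open import Data.Sum using (_⊎_; inj₁; inj₂)
open import Data.Empty using (⊥-elim)
open import Data.Product using (_×_; _,_; proj₁; proj₂; ∃)
open import Relation.Nullary using (¬_; does; yes; no)
open import Relation.Binary.PropositionalEquality
open import Algebra.Bundles using (CommutativeSemiring)

map-cancel : ∀ {A : Set} {n} (f g : A → A) → (∀ x → f (g x) ≡ x) → ∀ (v : Vec A n) → map f (map g v) ≡ v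
map-cancel f g f∘g≗id v = trans (sym (map-∘ f g v)) (trans (map-cong f∘g≗id v) (map-id v))

module PrimeField (p : ℕ) .{{_ : NonZero p}} where
  open Fp p

  ⟦_⟧ : ℕ → F
  ⟦ m ⟧ = m mod p

  toℕ-⟦⟧ : ∀ m → toℕ ⟦ m ⟧ ≡ m % p
  toℕ-⟦⟧ m = toℕ-fromℕ< (m%n<n m p)

  ⟦⟧-≡ : ∀ {m n} → m % p ≡ n % p → ⟦ m ⟧ ≡ ⟦ n ⟧
  ⟦⟧-≡ {m} {n} eq = toℕ-injective (trans (toℕ-⟦⟧ m) (trans eq (sym (toℕ-⟦⟧ n))))

  ⟦toℕ⟧ : ∀ x → ⟦ toℕ x ⟧ ≡ x
  ⟦toℕ⟧ x = toℕ-injective (trans (toℕ-⟦⟧ (toℕ x)) (m<n⇒m%n≡m (toℕ<n x)))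

  toℕ-0F : toℕ 0F ≡ 0
  toℕ-0F = trans (toℕ-⟦⟧ 0) (m<n⇒m%n≡m (>-nonZero⁻¹ p))

  -- ⟦_⟧ is a semiring homomorphism ℕ → F_p; all laws of F_p are lifted from ℕ.
  ⟦⟧-+ : ∀ m n → ⟦ m ⟧ +F ⟦ n ⟧ ≡ ⟦ m + n ⟧
  ⟦⟧-+ m n = ⟦⟧-≡ (begin
    (toℕ ⟦ m ⟧ + toℕ ⟦ n ⟧) % p ≡⟨ cong₂ (λ a b → (a + b) % p) (toℕ-⟦⟧ m) (toℕ-⟦⟧ n) ⟩
    (m % p + n % p) % p         ≡⟨ %-distribˡ-+ m n p ⟨
    (m + n) % p                 ∎)
    where open ≡-Reasoning

  ⟦⟧-* : ∀ m n → ⟦ m ⟧ *F ⟦ n ⟧ ≡ ⟦ m * n ⟧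
  ⟦⟧-* m n = ⟦⟧-≡ (begin
    (toℕ ⟦ m ⟧ * toℕ ⟦ n ⟧) % p ≡⟨ cong₂ (λ a b → (a * b) % p) (toℕ-⟦⟧ m) (toℕ-⟦⟧ n) ⟩
    (m % p * (n % p)) % p       ≡⟨ %-distribˡ-* m n p ⟨
    (m * n) % p                 ∎)
    where open ≡-Reasoning

  +F-comm : ∀ x y → x +F y ≡ y +F x
  +F-comm x y = cong ⟦_⟧ (ℕ.+-comm (toℕ x) (toℕ y))

  *F-comm : ∀ x y → x *F y ≡ y *F x
  *F-comm x y = cong ⟦_⟧ (ℕ.*-comm (toℕ x) (toℕ y))

  +F-assoc : ∀ x y z → (x +F y) +F z ≡ x +F (y +F z)
  +F-assoc x y z = begin
    (x +F y) +F z                 ≡⟨ cong ((x +F y) +F_) (⟦toℕ⟧ z) ⟨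
    (x +F y) +F ⟦ toℕ z ⟧         ≡⟨ ⟦⟧-+ (toℕ x + toℕ y) (toℕ z) ⟩
    ⟦ toℕ x + toℕ y + toℕ z ⟧     ≡⟨ cong ⟦_⟧ (ℕ.+-assoc (toℕ x) (toℕ y) (toℕ z)) ⟩
    ⟦ toℕ x + (toℕ y + toℕ z) ⟧   ≡⟨ ⟦⟧-+ (toℕ x) (toℕ y + toℕ z) ⟨
    ⟦ toℕ x ⟧ +F (y +F z)         ≡⟨ cong (_+F (y +F z)) (⟦toℕ⟧ x) ⟩
    x +F (y +F z)                 ∎
    where open ≡-Reasoning

  *F-assoc : ∀ x y z → (x *F y) *F z ≡ x *F (y *F z)
  *F-assoc x y z = begin
    (x *F y) *F z                 ≡⟨ cong ((x *F y) *F_) (⟦toℕ⟧ z) ⟨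
    (x *F y) *F ⟦ toℕ z ⟧         ≡⟨ ⟦⟧-* (toℕ x * toℕ y) (toℕ z) ⟩
    ⟦ toℕ x * toℕ y * toℕ z ⟧     ≡⟨ cong ⟦_⟧ (ℕ.*-assoc (toℕ x) (toℕ y) (toℕ z)) ⟩
    ⟦ toℕ x * (toℕ y * toℕ z) ⟧   ≡⟨ ⟦⟧-* (toℕ x) (toℕ y * toℕ z) ⟨
    ⟦ toℕ x ⟧ *F (y *F z)         ≡⟨ cong (_*F (y *F z)) (⟦toℕ⟧ x) ⟩
    x *F (y *F z)                 ∎
    where open ≡-Reasoning

  *F-distribˡ : ∀ x y z → x *F (y +F z) ≡ x *F y +F x *F z
  *F-distribˡ x y z = begin
    x *F (y +F z)                          ≡⟨ cong (_*F (y +F z)) (⟦toℕ⟧ x) ⟨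
    ⟦ toℕ x ⟧ *F (y +F z)                  ≡⟨ ⟦⟧-* (toℕ x) (toℕ y + toℕ z) ⟩
    ⟦ toℕ x * (toℕ y + toℕ z) ⟧            ≡⟨ cong ⟦_⟧ (ℕ.*-distribˡ-+ (toℕ x) (toℕ y) (toℕ z)) ⟩
    ⟦ toℕ x * toℕ y + toℕ x * toℕ z ⟧      ≡⟨ ⟦⟧-+ (toℕ x * toℕ y) (toℕ x * toℕ z) ⟨
    x *F y +F x *F z                       ∎
    where open ≡-Reasoning

  *F-distribʳ : ∀ x y z → (y +F z) *F x ≡ y *F x +F z *F x
  *F-distribʳ x y z = trans (*F-comm (y +F z) x)
    (trans (*F-distribˡ x y z) (cong₂ _+F_ (*F-comm x y) (*F-comm x z)))

  +F-identityˡ : ∀ x → 0F +F x ≡ x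
  +F-identityˡ x = begin
    0F +F x             ≡⟨ cong (0F +F_) (⟦toℕ⟧ x) ⟨
    ⟦ 0 ⟧ +F ⟦ toℕ x ⟧  ≡⟨ ⟦⟧-+ 0 (toℕ x) ⟩
    ⟦ toℕ x ⟧           ≡⟨ ⟦toℕ⟧ x ⟩
    x                   ∎
    where open ≡-Reasoning

  *F-identityˡ : ∀ x → 1F *F x ≡ x
  *F-identityˡ x = begin
    1F *F x             ≡⟨ cong (1F *F_) (⟦toℕ⟧ x) ⟨
    ⟦ 1 ⟧ *F ⟦ toℕ x ⟧  ≡⟨ ⟦⟧-* 1 (toℕ x) ⟩
    ⟦ 1 * toℕ x ⟧       ≡⟨ cong ⟦_⟧ (ℕ.*-identityˡ (toℕ x)) ⟩
    ⟦ toℕ x ⟧           ≡⟨ ⟦toℕ⟧ x ⟩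
    x                   ∎
    where open ≡-Reasoning

  *F-zeroˡ : ∀ x → 0F *F x ≡ 0F
  *F-zeroˡ x = trans (cong (0F *F_) (sym (⟦toℕ⟧ x))) (⟦⟧-* 0 (toℕ x))

  F-commutativeSemiring : CommutativeSemiring _ _
  F-commutativeSemiring = record
    { Carrier = F ; _≈_ = _≡_ ; _+_ = _+F_ ; _*_ = _*F_ ; 0# = 0F ; 1# = 1F
    ; isCommutativeSemiring = record
      { isSemiring = record
        { isSemiringWithoutAnnihilatingZero = record
          { +-isCommutativeMonoid = record
            { isMonoid = record
              { isSemigroup = record
                { isMagma = record { isEquivalence = isEquivalence ; ∙-cong = cong₂ _+F_ }
                ; assoc = +F-assoc }
              ; identity = +F-identityˡ , λ x → trans (+F-comm x 0F) (+F-identityˡ x) }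
            ; comm = +F-comm }
          ; *-cong = cong₂ _*F_
          ; *-assoc = *F-assoc
          ; *-identity = *F-identityˡ , λ x → trans (*F-comm x 1F) (*F-identityˡ x)
          ; distrib = *F-distribˡ , *F-distribʳ }
        ; zero = *F-zeroˡ , λ x → trans (*F-comm x 0F) (*F-zeroˡ x) }
      ; *-comm = *F-comm } }

  +F-inverseʳ : ∀ x → x +F ⟦ p ∸ toℕ x ⟧ ≡ 0F
  +F-inverseʳ x = begin
    x +F ⟦ p ∸ toℕ x ⟧             ≡⟨ cong (_+F ⟦ p ∸ toℕ x ⟧) (⟦toℕ⟧ x) ⟨
    ⟦ toℕ x ⟧ +F ⟦ p ∸ toℕ x ⟧     ≡⟨ ⟦⟧-+ (toℕ x) (p ∸ toℕ x) ⟩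
    ⟦ toℕ x + (p ∸ toℕ x) ⟧        ≡⟨ cong ⟦_⟧ (ℕ.m+[n∸m]≡n (ℕ.<⇒≤ (toℕ<n x))) ⟩
    ⟦ p ⟧                          ≡⟨ ⟦⟧-≡ ([m+n]%n≡m%n 0 p) ⟩
    0F                             ∎
    where open ≡-Reasoning

  -F-as-+F : ∀ x y → x -F y ≡ x +F ⟦ p ∸ toℕ y ⟧
  -F-as-+F x y = trans (sym (⟦⟧-+ (toℕ x) (p ∸ toℕ y))) (cong (_+F ⟦ p ∸ toℕ y ⟧) (⟦toℕ⟧ x))

  +F-identityʳ : ∀ x → x +F 0F ≡ x
  +F-identityʳ x = trans (+F-comm x 0F) (+F-identityˡ x)

  -F-+F : ∀ x y → (x -F y) +F y ≡ x
  -F-+F x y = begin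
    (x -F y) +F y                  ≡⟨ cong (_+F y) (-F-as-+F x y) ⟩
    (x +F ⟦ p ∸ toℕ y ⟧) +F y      ≡⟨ +F-assoc x _ y ⟩
    x +F (⟦ p ∸ toℕ y ⟧ +F y)      ≡⟨ cong (x +F_) (trans (+F-comm _ y) (+F-inverseʳ y)) ⟩
    x +F 0F                        ≡⟨ +F-identityʳ x ⟩
    x                              ∎
    where open ≡-Reasoning

  +F--F : ∀ x y → (x +F y) -F y ≡ x
  +F--F x y = begin
    (x +F y) -F y                  ≡⟨ -F-as-+F (x +F y) y ⟩
    (x +F y) +F ⟦ p ∸ toℕ y ⟧      ≡⟨ +F-assoc x y _ ⟩
    x +F (y +F ⟦ p ∸ toℕ y ⟧)      ≡⟨ cong (x +F_) (+F-inverseʳ y) ⟩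
    x +F 0F                        ≡⟨ +F-identityʳ x ⟩
    x                              ∎
    where open ≡-Reasoning

  +F-cancelʳ : ∀ {x y} z → x +F z ≡ y +F z → x ≡ y
  +F-cancelʳ {x} {y} z eq = trans (sym (+F--F x z)) (trans (cong (_-F z) eq) (+F--F y z))

  module _ (p-prime : Prime p) where

    divisible⇒0F : ∀ x → p ∣ toℕ x → x ≡ 0F
    divisible⇒0F x p∣x = toℕ-injective (begin
      toℕ x        ≡⟨ m<n⇒m%n≡m (toℕ<n x) ⟨
      toℕ x % p    ≡⟨ n∣m⇒m%n≡0 (toℕ x) p p∣x ⟩
      0            ≡⟨ toℕ-0F ⟨
      toℕ 0F       ∎)
      where open ≡-Reasoning

    *F-zero-divisor : ∀ x y → x *F y ≡ 0F → x ≡ 0F ⊎ y ≡ 0F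
    *F-zero-divisor x y xy≡0 with euclidsLemma (toℕ x) (toℕ y) p-prime p∣xy
      where
      p∣xy : p ∣ toℕ x * toℕ y
      p∣xy = m%n≡0⇒n∣m _ p (trans (sym (toℕ-⟦⟧ _)) (trans (cong toℕ xy≡0) toℕ-0F))
    ... | inj₁ p∣x = inj₁ (divisible⇒0F x p∣x)
    ... | inj₂ p∣y = inj₂ (divisible⇒0F y p∣y)

    *F-cancelʳ-≢ : ∀ x y z → x *F z ≡ y *F z → ¬ x ≡ y → z ≡ 0F
    *F-cancelʳ-≢ x y z xz≡yz x≢y with *F-zero-divisor (x -F y) z [x-y]z≡0
      where
      [x-y]z≡0 : (x -F y) *F z ≡ 0F
      [x-y]z≡0 = +F-cancelʳ (y *F z) (begin
        (x -F y) *F z +F y *F z     ≡⟨ *F-distribʳ z (x -F y) y ⟨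
        ((x -F y) +F y) *F z        ≡⟨ cong (_*F z) (-F-+F x y) ⟩
        x *F z                      ≡⟨ xz≡yz ⟩
        y *F z                      ≡⟨ +F-identityˡ (y *F z) ⟨
        0F +F y *F z                ∎)
        where open ≡-Reasoning
    ... | inj₂ z≡0 = z≡0
    ... | inj₁ x-y≡0 = ⊥-elim (x≢y (trans (sym (-F-+F x y)) (trans (cong (_+F y) x-y≡0) (+F-identityˡ y))))

  -- When p ≡ 1 (mod 3), writing p = 1 + 3q, the element 2q + 1 inverts 3.
  three : F
  three = 1F +F 1F +F 1F

  third : F
  third = ⟦ 2 * (p / 3) + 1 ⟧

  three*third : p % 3 ≡ 1 → three *F third ≡ 1F
  three*third p%3≡1 = begin
    three *F third                   ≡⟨ cong (_*F third) (trans (cong (_+F 1F) (⟦⟧-+ 1 1)) (⟦⟧-+ 2 1)) ⟩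
    ⟦ 3 ⟧ *F third                   ≡⟨ ⟦⟧-* 3 (2 * q + 1) ⟩
    ⟦ 3 * (2 * q + 1) ⟧              ≡⟨ cong ⟦_⟧ (arith q) ⟩
    ⟦ 1 + 2 * (1 + q * 3) ⟧          ≡⟨ cong (λ m → ⟦ 1 + 2 * m ⟧) p≡1+3q ⟨
    ⟦ 1 + 2 * p ⟧                    ≡⟨ ⟦⟧-≡ ([m+kn]%n≡m%n 1 2 p) ⟩
    1F                               ∎
    where
    open ≡-Reasoning
    q = p / 3
    p≡1+3q : p ≡ 1 + q * 3
    p≡1+3q = trans (m≡m%n+[m/n]*n p 3) (cong (_+ q * 3) p%3≡1)
    arith : ∀ q → 3 * (2 * q + 1) ≡ 1 + 2 * (1 + q * 3)
    arith = solve 1 (λ q → con 3 :* (con 2 :* q :+ con 1) := con 1 :+ con 2 :* (con 1 :+ q :* con 3)) refl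
      where open ℕ-Solver.+-*-Solver

  third-cancels-three : p % 3 ≡ 1 → ∀ x → third *F (three *F x) ≡ x
  third-cancels-three p%3≡1 x = begin
    third *F (three *F x)   ≡⟨ *F-assoc third three x ⟨
    (third *F three) *F x   ≡⟨ cong (_*F x) (trans (*F-comm third three) (three*third p%3≡1)) ⟩
    1F *F x                 ≡⟨ *F-identityˡ x ⟩
    x                       ∎
    where open ≡-Reasoning

module FpVectors (p : ℕ) .{{_ : NonZero p}} where
  open Fp p
  open PrimeField p
  open import Algebra.Solver.Ring.NaturalCoefficients.Default F-commutativeSemiring

  +F-fixes⇔0 : ∀ e v → does ((e +F v) ≟ v) ≡ does (e ≟ 0F)
  +F-fixes⇔0 e v with (e +F v) ≟ v | e ≟ 0F
  ... | yes _   | yes _   = refl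
  ... | no _    | no _    = refl
  ... | yes e+v≡v | no e≢0 = ⊥-elim (e≢0 (+F-cancelʳ v (trans e+v≡v (sym (+F-identityˡ v)))))
  ... | no e+v≢v | yes e≡0 = ⊥-elim (e+v≢v (trans (cong (_+F v) e≡0) (+F-identityˡ v)))

  hammingDist-translate : ∀ {m} (e v : Vec F m) → hammingDist (e +Fⁿ v) v ≡ hammingWeight e
  hammingDist-translate [] [] = refl
  hammingDist-translate (a ∷ e) (b ∷ v)
    rewrite +F-fixes⇔0 a b | hammingDist-translate e v = refl

  _⊙_ : ∀ {m} → Vec F m → Vec F m → Vec F m
  u ⊙ v = zipWith _*F_ u v

  dot-++ : ∀ {m k} (u v : Vec F m) (a b : Vec F k) → dotF (u ++ a) (v ++ b) ≡ dotF u v +F dotF a b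
  dot-++ [] [] a b = sym (+F-identityˡ (dotF a b))
  dot-++ (x ∷ u) (y ∷ v) a b = begin
    x *F y +F dotF (u ++ a) (v ++ b)     ≡⟨ cong (x *F y +F_) (dot-++ u v a b) ⟩
    x *F y +F (dotF u v +F dotF a b)     ≡⟨ +F-assoc (x *F y) _ _ ⟨
    x *F y +F dotF u v +F dotF a b       ∎
    where open ≡-Reasoning

  dot-+ʳ : ∀ {m} (u v w : Vec F m) → dotF u (v +Fⁿ w) ≡ dotF u v +F dotF u w
  dot-+ʳ [] [] [] = solve 0 (con 0 := con 0 :+ con 0) refl
  dot-+ʳ (x ∷ u) (y ∷ v) (z ∷ w) = begin
    x *F (y +F z) +F dotF u (v +Fⁿ w)            ≡⟨ cong (x *F (y +F z) +F_) (dot-+ʳ u v w) ⟩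
    x *F (y +F z) +F (dotF u v +F dotF u w)      ≡⟨ solve 5 (λ x y z s t → x :* (y :+ z) :+ (s :+ t)
                                                        := (x :* y :+ s) :+ (x :* z :+ t)) refl x y z _ _ ⟩
    (x *F y +F dotF u v) +F (x *F z +F dotF u w) ∎
    where open ≡-Reasoning

  dot-⊙-swap : ∀ {m} (u v w : Vec F m) → dotF u (v ⊙ w) ≡ dotF v (u ⊙ w)
  dot-⊙-swap [] [] [] = refl
  dot-⊙-swap (x ∷ u) (y ∷ v) (z ∷ w) =
    cong₂ _+F_ (solve 3 (λ x y z → x :* (y :* z) := y :* (x :* z)) refl x y z) (dot-⊙-swap u v w)

  dot-zeroˡ : ∀ {m} (v : Vec F m) → dotF (replicate m 0F) v ≡ 0F
  dot-zeroˡ [] = refl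
  dot-zeroˡ (x ∷ v) = trans (cong (0F *F x +F_) (dot-zeroˡ v)) (solve 1 (λ x → con 0 :* x :+ con 0 := con 0) refl x)

  dot-zeroʳ : ∀ {m} (u : Vec F m) → dotF u (replicate m 0F) ≡ 0F
  dot-zeroʳ [] = refl
  dot-zeroʳ (x ∷ u) = trans (cong (x *F 0F +F_) (dot-zeroʳ u)) (solve 1 (λ x → x :* con 0 :+ con 0 := con 0) refl x)

  dot-nondegenerate : ∀ {m} (v : Vec F m) → (∀ w → dotF w v ≡ 0F) → v ≡ replicate m 0F
  dot-nondegenerate [] _ = refl
  dot-nondegenerate {suc m} (x ∷ v) ⊥v = cong₂ _∷_ x≡0 (dot-nondegenerate v ⊥v-tail)
    where
    x≡0 : x ≡ 0F
    x≡0 = begin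
      x                                    ≡⟨ solve 1 (λ x → x := con 1 :* x :+ con 0) refl x ⟩
      1F *F x +F 0F                        ≡⟨ cong (1F *F x +F_) (dot-zeroˡ v) ⟨
      dotF (1F ∷ replicate m 0F) (x ∷ v)   ≡⟨ ⊥v (1F ∷ replicate m 0F) ⟩
      0F                                   ∎
      where open ≡-Reasoning
    ⊥v-tail : ∀ w → dotF w v ≡ 0F
    ⊥v-tail w = begin
      dotF w v                   ≡⟨ solve 2 (λ x d → d := con 0 :* x :+ d) refl x (dotF w v) ⟩
      dotF (0F ∷ w) (x ∷ v)      ≡⟨ ⊥v (0F ∷ w) ⟩
      0F                         ∎
      where open ≡-Reasoning

module CoefficientRing (p : ℕ) .{{_ : NonZero p}} where
  open Fp p
  open PrimeField p
  open import Algebra.Solver.Ring.NaturalCoefficients.Default F-commutativeSemiring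

  R-≡ : ∀ {a b c d a' b' c' d'} → a ≡ a' → b ≡ b' → c ≡ c' → d ≡ d' → ⟨ a , b , c , d ⟩ ≡ ⟨ a' , b' , c' , d' ⟩
  R-≡ refl refl refl refl = refl

  constR : F → R
  constR k = ⟨ k , 0F , 0F , 0F ⟩

  constR-*R : ∀ k r → constR k *R r ≡ k ·R r
  constR-*R k ⟨ b₀ , b₁ , b₂ , b₃ ⟩ = R-≡ refl
    (solve 5 (λ k b₀ b₁ b₂ b₃ → k :* b₁ :+ con 0 :* b₀ :+ con 0 :* b₃ :+ con 0 :* b₂ :+ con 0 :* b₁ := k :* b₁) refl k b₀ b₁ b₂ b₃)
    (solve 5 (λ k b₀ b₁ b₂ b₃ → k :* b₂ :+ con 0 :* b₁ :+ con 0 :* b₀ :+ con 0 :* b₃ :+ con 0 :* b₂ := k :* b₂) refl k b₀ b₁ b₂ b₃)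
    (solve 5 (λ k b₀ b₁ b₂ b₃ → k :* b₃ :+ con 0 :* b₂ :+ con 0 :* b₁ :+ con 0 :* b₀ :+ con 0 :* b₃ := k :* b₃) refl k b₀ b₁ b₂ b₃)

  ·R-identity : ∀ r → 1F ·R r ≡ r
  ·R-identity ⟨ a , b , c , d ⟩ = R-≡ (*F-identityˡ a) (*F-identityˡ b) (*F-identityˡ c) (*F-identityˡ d)

  -R-+R : ∀ r s → (r -R s) +R s ≡ r
  -R-+R ⟨ a , b , c , d ⟩ ⟨ a' , b' , c' , d' ⟩ = R-≡ (-F-+F a a') (-F-+F b b') (-F-+F c c') (-F-+F d d')

  constR-*Rⁿ : ∀ {n} k (x : Vec R n) → constR k *Rⁿ x ≡ k ·Rⁿ x
  constR-*Rⁿ k = map-cong (constR-*R k)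

  ·Rⁿ-identity : ∀ {n} (x : Vec R n) → 1F ·Rⁿ x ≡ x
  ·Rⁿ-identity x = trans (map-cong ·R-identity x) (map-id x)

  -Rⁿ-+Rⁿ : ∀ {n} (x y : Vec R n) → (x -Rⁿ y) +Rⁿ y ≡ x
  -Rⁿ-+Rⁿ [] [] = refl
  -Rⁿ-+Rⁿ (r ∷ x) (s ∷ y) = cong₂ _∷_ (-R-+R r s) (-Rⁿ-+Rⁿ x y)

  ev : F → R → F
  ev η ⟨ a , b , c , d ⟩ = a +F b *F η +F c *F (η *F η) +F d *F (η *F η *F η)

  ev-+R : ∀ η r s → ev η (r +R s) ≡ ev η r +F ev η s
  ev-+R η ⟨ a₀ , a₁ , a₂ , a₃ ⟩ ⟨ b₀ , b₁ , b₂ , b₃ ⟩ = solve 9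
    (λ a₀ a₁ a₂ a₃ b₀ b₁ b₂ b₃ η →
      (a₀ :+ b₀) :+ (a₁ :+ b₁) :* η :+ (a₂ :+ b₂) :* (η :* η) :+ (a₃ :+ b₃) :* (η :* η :* η)
      := (a₀ :+ a₁ :* η :+ a₂ :* (η :* η) :+ a₃ :* (η :* η :* η)) :+ (b₀ :+ b₁ :* η :+ b₂ :* (η :* η) :+ b₃ :* (η :* η :* η)))
    refl a₀ a₁ a₂ a₃ b₀ b₁ b₂ b₃ η

  ev-·R : ∀ η k r → ev η (k ·R r) ≡ k *F ev η r
  ev-·R η k ⟨ a , b , c , d ⟩ = solve 6
    (λ η k a b c d →
      k :* a :+ k :* b :* η :+ k :* c :* (η :* η) :+ k :* d :* (η :* η :* η)
      := k :* (a :+ b :* η :+ c :* (η :* η) :+ d :* (η :* η :* η)))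
    refl η k a b c d

  -- At a root of X⁴ − X (the relation u⁴ = u), evaluation is multiplicative:
  -- ev(r)ev(s) = L + η⁴H while ev(rs) = L + ηH, where the terms of degree ≥ 4
  -- have been folded back using u⁴ = u.
  ev-*R : ∀ η → η *F η *F η *F η ≡ η → ∀ r s → ev η (r *R s) ≡ ev η r *F ev η s
  ev-*R η η⁴≡η ⟨ a₀ , a₁ , a₂ , a₃ ⟩ ⟨ b₀ , b₁ , b₂ , b₃ ⟩ = begin
    ev η (⟨ a₀ , a₁ , a₂ , a₃ ⟩ *R ⟨ b₀ , b₁ , b₂ , b₃ ⟩) ≡⟨ solve 9
      (λ a₀ a₁ a₂ a₃ b₀ b₁ b₂ b₃ η →
        a₀ :* b₀ :+ (a₀ :* b₁ :+ a₁ :* b₀ :+ a₁ :* b₃ :+ a₂ :* b₂ :+ a₃ :* b₁) :* η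
         :+ (a₀ :* b₂ :+ a₁ :* b₁ :+ a₂ :* b₀ :+ a₂ :* b₃ :+ a₃ :* b₂) :* (η :* η)
         :+ (a₀ :* b₃ :+ a₁ :* b₂ :+ a₂ :* b₁ :+ a₃ :* b₀ :+ a₃ :* b₃) :* (η :* η :* η)
        := L̂ a₀ a₁ a₂ a₃ b₀ b₁ b₂ b₃ η :+ η :* Ĥ a₁ a₂ a₃ b₁ b₂ b₃ η)
      refl a₀ a₁ a₂ a₃ b₀ b₁ b₂ b₃ η ⟩
    L +F η *F H                    ≡⟨ cong (λ t → L +F t *F H) η⁴≡η ⟨
    L +F (η *F η *F η *F η) *F H   ≡⟨ solve 9
      (λ a₀ a₁ a₂ a₃ b₀ b₁ b₂ b₃ η →
        L̂ a₀ a₁ a₂ a₃ b₀ b₁ b₂ b₃ η :+ (η :* η :* η :* η) :* Ĥ a₁ a₂ a₃ b₁ b₂ b₃ η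
        := (a₀ :+ a₁ :* η :+ a₂ :* (η :* η) :+ a₃ :* (η :* η :* η)) :* (b₀ :+ b₁ :* η :+ b₂ :* (η :* η) :+ b₃ :* (η :* η :* η)))
      refl a₀ a₁ a₂ a₃ b₀ b₁ b₂ b₃ η ⟩
    ev η ⟨ a₀ , a₁ , a₂ , a₃ ⟩ *F ev η ⟨ b₀ , b₁ , b₂ , b₃ ⟩ ∎
    where
    open ≡-Reasoning
    -- the terms of degree ≤ 3 and (divided by u⁴) of degree ≥ 4 of the product
    L̂ : ∀ {m} (a₀ a₁ a₂ a₃ b₀ b₁ b₂ b₃ η : Polynomial m) → Polynomial m
    L̂ a₀ a₁ a₂ a₃ b₀ b₁ b₂ b₃ η = a₀ :* b₀ :+ (a₀ :* b₁ :+ a₁ :* b₀) :* η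
      :+ (a₀ :* b₂ :+ a₁ :* b₁ :+ a₂ :* b₀) :* (η :* η) :+ (a₀ :* b₃ :+ a₁ :* b₂ :+ a₂ :* b₁ :+ a₃ :* b₀) :* (η :* η :* η)
    Ĥ : ∀ {m} (a₁ a₂ a₃ b₁ b₂ b₃ η : Polynomial m) → Polynomial m
    Ĥ a₁ a₂ a₃ b₁ b₂ b₃ η = (a₁ :* b₃ :+ a₂ :* b₂ :+ a₃ :* b₁) :+ (a₂ :* b₃ :+ a₃ :* b₂) :* η :+ a₃ :* b₃ :* (η :* η)
    L H : F
    L = a₀ *F b₀ +F (a₀ *F b₁ +F a₁ *F b₀) *F η
      +F (a₀ *F b₂ +F a₁ *F b₁ +F a₂ *F b₀) *F (η *F η) +F (a₀ *F b₃ +F a₁ *F b₂ +F a₂ *F b₁ +F a₃ *F b₀) *F (η *F η *F η)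
    H = (a₁ *F b₃ +F a₂ *F b₂ +F a₃ *F b₁) +F (a₂ *F b₃ +F a₃ *F b₂) *F η +F a₃ *F b₃ *F (η *F η)

  ev-0R : ∀ η → ev η 0R ≡ 0F
  ev-0R η = solve 1 (λ η → con 0 :+ con 0 :* η :+ con 0 :* (η :* η) :+ con 0 :* (η :* η :* η) := con 0) refl η

module GrayMap (p : ℕ) .{{_ : NonZero p}} (p-prime : Prime p) (p%3≡1 : p % 3 ≡ 1)
               (ξ : Fp.F p) (ξ-primitive : Fp.PrimitiveCubeRoot p ξ) where
  open Fp p
  open PrimeField p
  open FpVectors p
  open CoefficientRing p
  open Gray ξ
  open import Algebra.Solver.Ring.NaturalCoefficients.Default F-commutativeSemiring

  ξ² : F
  ξ² = ξ *F ξ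

  ξ³≡1 : ξ *F ξ *F ξ ≡ 1F
  ξ³≡1 = proj₁ ξ-primitive

  by-ξ³≡1 : ∀ (G : F → F) {l r} → l ≡ G (ξ *F ξ *F ξ) → G 1F ≡ r → l ≡ r
  by-ξ³≡1 G l≡G[ξ³] G[1]≡r = trans l≡G[ξ³] (trans (cong G ξ³≡1) G[1]≡r)

  -- ξ ≠ 1 is a root of X³ − 1 = (X − 1)(1 + X + X²), hence of 1 + X + X².
  1+ξ+ξ²≡0 : 1F +F ξ +F ξ² ≡ 0F
  1+ξ+ξ²≡0 = *F-cancelʳ-≢ p-prime ξ 1F (1F +F ξ +F ξ²) ξσ≡σ (proj₂ ξ-primitive)
    where
    ξσ≡σ : ξ *F (1F +F ξ +F ξ²) ≡ 1F *F (1F +F ξ +F ξ²)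
    ξσ≡σ = by-ξ³≡1 (λ t → ξ +F ξ² +F t)
      (solve 1 (λ x → x :* (con 1 :+ x :+ x :* x) := x :+ x :* x :+ x :* x :* x) refl ξ)
      (solve 1 (λ x → x :+ x :* x :+ con 1 := con 1 :* (con 1 :+ x :+ x :* x)) refl ξ)

  ξ²ξ²≡ξ : ξ² *F ξ² ≡ ξ
  ξ²ξ²≡ξ = by-ξ³≡1 (_*F ξ) (solve 1 (λ x → (x :* x) :* (x :* x) := x :* x :* x :* x) refl ξ) (*F-identityˡ ξ)

  1+ξ²+ξ⁴≡0 : 1F +F ξ² +F ξ² *F ξ² ≡ 0F
  1+ξ²+ξ⁴≡0 = trans (cong (1F +F ξ² +F_) ξ²ξ²≡ξ)
    (trans (solve 1 (λ x → con 1 :+ x :* x :+ x := con 1 :+ x :+ x :* x) refl ξ) 1+ξ+ξ²≡0)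

  1+ξ³+ξ³≡3 : 1F +F ξ *F ξ *F ξ +F ξ *F ξ *F ξ ≡ three
  1+ξ³+ξ³≡3 = cong (λ t → 1F +F t +F t) ξ³≡1

  0⁴≡0 : 0F *F 0F *F 0F *F 0F ≡ 0F
  0⁴≡0 = solve 0 (con 0 :* con 0 :* con 0 :* con 0 := con 0) refl

  1⁴≡1 : 1F *F 1F *F 1F *F 1F ≡ 1F
  1⁴≡1 = solve 0 (con 1 :* con 1 :* con 1 :* con 1 := con 1) refl

  ξ⁴≡ξ : ξ *F ξ *F ξ *F ξ ≡ ξ
  ξ⁴≡ξ = trans (cong (_*F ξ) ξ³≡1) (*F-identityˡ ξ)

  [ξ²]⁴≡ξ² : ξ² *F ξ² *F ξ² *F ξ² ≡ ξ²
  [ξ²]⁴≡ξ² = trans (solve 1 (λ y → y :* y :* y :* y := (y :* y) :* (y :* y)) refl ξ²) (cong₂ _*F_ ξ²ξ²≡ξ ξ²ξ²≡ξ)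

  vec4-≡ : ∀ {a b c d a' b' c' d' : F} → a ≡ a' → b ≡ b' → c ≡ c' → d ≡ d' →
           a ∷ b ∷ c ∷ d ∷ [] ≡ a' ∷ b' ∷ c' ∷ d' ∷ []
  vec4-≡ refl refl refl refl = refl

  evaluations : R → Vec F 4
  evaluations r = ev 0F r ∷ ev 1F r ∷ ev ξ² r ∷ ev ξ r ∷ []

  Ψ₁≡evaluations : ∀ r → Ψ₁ r ≡ evaluations r
  Ψ₁≡evaluations ⟨ a , b , c , d ⟩ = vec4-≡
    (solve 4 (λ a b c d → a := a :+ b :* con 0 :+ c :* (con 0 :* con 0) :+ d :* (con 0 :* con 0 :* con 0)) refl a b c d)
    (solve 4 (λ a b c d → a :+ b :+ c :+ d := a :+ b :* con 1 :+ c :* (con 1 :* con 1) :+ d :* (con 1 :* con 1 :* con 1)) refl a b c d)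
    (sym (by-ξ³≡1 (λ t → a +F b *F ξ² +F c *F (t *F ξ) +F d *F (t *F t))
      (solve 5 (λ a b c d x → a :+ b :* (x :* x) :+ c :* ((x :* x) :* (x :* x)) :+ d :* ((x :* x) :* (x :* x) :* (x :* x))
                 := a :+ b :* (x :* x) :+ c :* ((x :* x :* x) :* x) :+ d :* ((x :* x :* x) :* (x :* x :* x))) refl a b c d ξ)
      (solve 5 (λ a b c d x → a :+ b :* (x :* x) :+ c :* (con 1 :* x) :+ d :* (con 1 :* con 1)
                 := a :+ b :* (x :* x) :+ c :* x :+ d) refl a b c d ξ)))
    (sym (by-ξ³≡1 (λ t → a +F b *F ξ +F c *F ξ² +F d *F t) refl
      (solve 5 (λ a b c d x → a :+ b :* x :+ c :* (x :* x) :+ d :* con 1 := a :+ b :* x :+ c :* (x :* x) :+ d) refl a b c d ξ)))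

  Ψ₁-+R : ∀ r s → Ψ₁ (r +R s) ≡ Ψ₁ r +Fⁿ Ψ₁ s
  Ψ₁-+R r s = trans (Ψ₁≡evaluations (r +R s))
    (trans (vec4-≡ (ev-+R 0F r s) (ev-+R 1F r s) (ev-+R ξ² r s) (ev-+R ξ r s))
           (sym (cong₂ _+Fⁿ_ (Ψ₁≡evaluations r) (Ψ₁≡evaluations s))))

  Ψ₁-·R : ∀ k r → Ψ₁ (k ·R r) ≡ k ·Fⁿ Ψ₁ r
  Ψ₁-·R k r = trans (Ψ₁≡evaluations (k ·R r))
    (trans (vec4-≡ (ev-·R 0F k r) (ev-·R 1F k r) (ev-·R ξ² k r) (ev-·R ξ k r))
           (sym (cong (k ·Fⁿ_) (Ψ₁≡evaluations r))))

  Ψ₁-*R : ∀ r s → Ψ₁ (r *R s) ≡ Ψ₁ r ⊙ Ψ₁ s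
  Ψ₁-*R r s = trans (Ψ₁≡evaluations (r *R s))
    (trans (vec4-≡ (ev-*R 0F 0⁴≡0 r s) (ev-*R 1F 1⁴≡1 r s) (ev-*R ξ² [ξ²]⁴≡ξ² r s) (ev-*R ξ ξ⁴≡ξ r s))
           (sym (cong₂ _⊙_ (Ψ₁≡evaluations r) (Ψ₁≡evaluations s))))

  Ψ₁-0R : Ψ₁ 0R ≡ replicate 4 0F
  Ψ₁-0R = trans (Ψ₁≡evaluations 0R) (vec4-≡ (ev-0R 0F) (ev-0R 1F) (ev-0R ξ²) (ev-0R ξ))

  -- On the coordinates b, c, d, Ψ₁ acts by the 3-point discrete Fourier transform
  -- over the cube roots of unity; idft inverts it up to the factor 3.
  dft : Vec F 3 → Vec F 3
  dft (b ∷ c ∷ d ∷ []) = (b +F c +F d) ∷ (b *F ξ² +F c *F ξ +F d) ∷ (b *F ξ +F c *F ξ² +F d) ∷ []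

  idft : Vec F 3 → Vec F 3
  idft (x ∷ y ∷ z ∷ []) = (x +F y *F ξ +F z *F ξ²) ∷ (x +F y *F ξ² +F z *F ξ) ∷ (x +F y +F z) ∷ []

  vec3-≡ : ∀ {a b c a' b' c' : F} → a ≡ a' → b ≡ b' → c ≡ c' → a ∷ b ∷ c ∷ [] ≡ a' ∷ b' ∷ c' ∷ []
  vec3-≡ refl refl refl = refl

  linear₃ : ∀ b c d {P Q S P' Q' S'} → P ≡ P' → Q ≡ Q' → S ≡ S' →
            b *F P +F c *F Q +F d *F S ≡ b *F P' +F c *F Q' +F d *F S'
  linear₃ b c d refl refl refl = refl

  -- Each entry of idft ∘ dft and dft ∘ idft is a coefficient-wise sum
  -- 1 + ζ + ζ² over cube roots ζ: it is 3 for ζ = 1 and 0 for ζ = ξ, ξ².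
  idft-dft : ∀ v → idft (dft v) ≡ three ·Fⁿ v
  idft-dft (b ∷ c ∷ d ∷ []) = vec3-≡
    (begin
      (b +F c +F d) +F (b *F ξ² +F c *F ξ +F d) *F ξ +F (b *F ξ +F c *F ξ² +F d) *F ξ²
        ≡⟨ solve 4 (λ b c d x →
             (b :+ c :+ d) :+ (b :* (x :* x) :+ c :* x :+ d) :* x :+ (b :* x :+ c :* (x :* x) :+ d) :* (x :* x)
             := b :* (con 1 :+ x :* x :* x :+ x :* x :* x) :+ c :* (con 1 :+ x :* x :+ (x :* x) :* (x :* x))
                :+ d :* (con 1 :+ x :+ x :* x)) refl b c d ξ ⟩
      b *F (1F +F ξ *F ξ *F ξ +F ξ *F ξ *F ξ) +F c *F (1F +F ξ² +F ξ² *F ξ²) +F d *F (1F +F ξ +F ξ²)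
        ≡⟨ linear₃ b c d 1+ξ³+ξ³≡3 1+ξ²+ξ⁴≡0 1+ξ+ξ²≡0 ⟩
      b *F three +F c *F 0F +F d *F 0F
        ≡⟨ solve 3 (λ b c d → b :* (con 1 :+ con 1 :+ con 1) :+ c :* con 0 :+ d :* con 0 := (con 1 :+ con 1 :+ con 1) :* b) refl b c d ⟩
      three *F b ∎)
    (begin
      (b +F c +F d) +F (b *F ξ² +F c *F ξ +F d) *F ξ² +F (b *F ξ +F c *F ξ² +F d) *F ξ
        ≡⟨ solve 4 (λ b c d x →
             (b :+ c :+ d) :+ (b :* (x :* x) :+ c :* x :+ d) :* (x :* x) :+ (b :* x :+ c :* (x :* x) :+ d) :* x
             := b :* (con 1 :+ x :* x :+ (x :* x) :* (x :* x)) :+ c :* (con 1 :+ x :* x :* x :+ x :* x :* x)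
                :+ d :* (con 1 :+ x :+ x :* x)) refl b c d ξ ⟩
      b *F (1F +F ξ² +F ξ² *F ξ²) +F c *F (1F +F ξ *F ξ *F ξ +F ξ *F ξ *F ξ) +F d *F (1F +F ξ +F ξ²)
        ≡⟨ linear₃ b c d 1+ξ²+ξ⁴≡0 1+ξ³+ξ³≡3 1+ξ+ξ²≡0 ⟩
      b *F 0F +F c *F three +F d *F 0F
        ≡⟨ solve 3 (λ b c d → b :* con 0 :+ c :* (con 1 :+ con 1 :+ con 1) :+ d :* con 0 := (con 1 :+ con 1 :+ con 1) :* c) refl b c d ⟩
      three *F c ∎)
    (begin
      (b +F c +F d) +F (b *F ξ² +F c *F ξ +F d) +F (b *F ξ +F c *F ξ² +F d)
        ≡⟨ solve 4 (λ b c d x →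
             (b :+ c :+ d) :+ (b :* (x :* x) :+ c :* x :+ d) :+ (b :* x :+ c :* (x :* x) :+ d)
             := b :* (con 1 :+ x :+ x :* x) :+ c :* (con 1 :+ x :+ x :* x) :+ d :* (con 1 :+ con 1 :+ con 1)) refl b c d ξ ⟩
      b *F (1F +F ξ +F ξ²) +F c *F (1F +F ξ +F ξ²) +F d *F three
        ≡⟨ linear₃ b c d 1+ξ+ξ²≡0 1+ξ+ξ²≡0 refl ⟩
      b *F 0F +F c *F 0F +F d *F three
        ≡⟨ solve 3 (λ b c d → b :* con 0 :+ c :* con 0 :+ d :* (con 1 :+ con 1 :+ con 1) := (con 1 :+ con 1 :+ con 1) :* d) refl b c d ⟩
      three *F d ∎)
    where open ≡-Reasoning

  dft-idft : ∀ v → dft (idft v) ≡ three ·Fⁿ v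
  dft-idft (x ∷ y ∷ z ∷ []) = vec3-≡
    (begin
      (x +F y *F ξ +F z *F ξ²) +F (x +F y *F ξ² +F z *F ξ) +F (x +F y +F z)
        ≡⟨ solve 4 (λ x y z w →
             (x :+ y :* w :+ z :* (w :* w)) :+ (x :+ y :* (w :* w) :+ z :* w) :+ (x :+ y :+ z)
             := x :* (con 1 :+ con 1 :+ con 1) :+ y :* (con 1 :+ w :+ w :* w) :+ z :* (con 1 :+ w :+ w :* w)) refl x y z ξ ⟩
      x *F three +F y *F (1F +F ξ +F ξ²) +F z *F (1F +F ξ +F ξ²)
        ≡⟨ linear₃ x y z refl 1+ξ+ξ²≡0 1+ξ+ξ²≡0 ⟩
      x *F three +F y *F 0F +F z *F 0F
        ≡⟨ solve 3 (λ x y z → x :* (con 1 :+ con 1 :+ con 1) :+ y :* con 0 :+ z :* con 0 := (con 1 :+ con 1 :+ con 1) :* x) refl x y z ⟩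
      three *F x ∎)
    (begin
      (x +F y *F ξ +F z *F ξ²) *F ξ² +F (x +F y *F ξ² +F z *F ξ) *F ξ +F (x +F y +F z)
        ≡⟨ solve 4 (λ x y z w →
             (x :+ y :* w :+ z :* (w :* w)) :* (w :* w) :+ (x :+ y :* (w :* w) :+ z :* w) :* w :+ (x :+ y :+ z)
             := x :* (con 1 :+ w :+ w :* w) :+ y :* (con 1 :+ w :* w :* w :+ w :* w :* w)
                :+ z :* (con 1 :+ w :* w :+ (w :* w) :* (w :* w))) refl x y z ξ ⟩
      x *F (1F +F ξ +F ξ²) +F y *F (1F +F ξ *F ξ *F ξ +F ξ *F ξ *F ξ) +F z *F (1F +F ξ² +F ξ² *F ξ²)
        ≡⟨ linear₃ x y z 1+ξ+ξ²≡0 1+ξ³+ξ³≡3 1+ξ²+ξ⁴≡0 ⟩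
      x *F 0F +F y *F three +F z *F 0F
        ≡⟨ solve 3 (λ x y z → x :* con 0 :+ y :* (con 1 :+ con 1 :+ con 1) :+ z :* con 0 := (con 1 :+ con 1 :+ con 1) :* y) refl x y z ⟩
      three *F y ∎)
    (begin
      (x +F y *F ξ +F z *F ξ²) *F ξ +F (x +F y *F ξ² +F z *F ξ) *F ξ² +F (x +F y +F z)
        ≡⟨ solve 4 (λ x y z w →
             (x :+ y :* w :+ z :* (w :* w)) :* w :+ (x :+ y :* (w :* w) :+ z :* w) :* (w :* w) :+ (x :+ y :+ z)
             := x :* (con 1 :+ w :+ w :* w) :+ y :* (con 1 :+ w :* w :+ (w :* w) :* (w :* w))
                :+ z :* (con 1 :+ w :* w :* w :+ w :* w :* w)) refl x y z ξ ⟩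
      x *F (1F +F ξ +F ξ²) +F y *F (1F +F ξ² +F ξ² *F ξ²) +F z *F (1F +F ξ *F ξ *F ξ +F ξ *F ξ *F ξ)
        ≡⟨ linear₃ x y z 1+ξ+ξ²≡0 1+ξ²+ξ⁴≡0 1+ξ³+ξ³≡3 ⟩
      x *F 0F +F y *F 0F +F z *F three
        ≡⟨ solve 3 (λ x y z → x :* con 0 :+ y :* con 0 :+ z :* (con 1 :+ con 1 :+ con 1) := (con 1 :+ con 1 :+ con 1) :* z) refl x y z ⟩
      three *F z ∎)
    where open ≡-Reasoning

  dft-· : ∀ k v → dft (k ·Fⁿ v) ≡ k ·Fⁿ dft v
  dft-· k (b ∷ c ∷ d ∷ []) = vec3-≡
    (solve 4 (λ k b c d → k :* b :+ k :* c :+ k :* d := k :* (b :+ c :+ d)) refl k b c d)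
    (solve 5 (λ k b c d x → k :* b :* (x :* x) :+ k :* c :* x :+ k :* d := k :* (b :* (x :* x) :+ c :* x :+ d)) refl k b c d ξ)
    (solve 5 (λ k b c d x → k :* b :* x :+ k :* c :* (x :* x) :+ k :* d := k :* (b :* x :+ c :* (x :* x) :+ d)) refl k b c d ξ)

  toR : F → Vec F 3 → R
  toR a (b ∷ c ∷ d ∷ []) = ⟨ a , b , c , d ⟩

  Ψ₁-toR : ∀ a v → Ψ₁ (toR a v) ≡ a ∷ map (a +F_) (dft v)
  Ψ₁-toR a (b ∷ c ∷ d ∷ []) = vec4-≡ refl
    (solve 4 (λ a b c d → a :+ b :+ c :+ d := a :+ (b :+ c :+ d)) refl a b c d)
    (solve 5 (λ a b c d x → a :+ b :* (x :* x) :+ c :* x :+ d := a :+ (b :* (x :* x) :+ c :* x :+ d)) refl a b c d ξ)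
    (solve 5 (λ a b c d x → a :+ b :* x :+ c :* (x :* x) :+ d := a :+ (b :* x :+ c :* (x :* x) :+ d)) refl a b c d ξ)

  Φ : Vec F 4 → R
  Φ (w₀ ∷ w) = toR w₀ (third ·Fⁿ idft (map (_-F w₀) w))

  Ψ₁-Φ : ∀ w → Ψ₁ (Φ w) ≡ w
  Ψ₁-Φ (w₀ ∷ w) = begin
    Ψ₁ (Φ (w₀ ∷ w))                               ≡⟨ Ψ₁-toR w₀ (third ·Fⁿ idft s) ⟩
    w₀ ∷ map (w₀ +F_) (dft (third ·Fⁿ idft s))    ≡⟨ cong (λ t → w₀ ∷ map (w₀ +F_) t) (dft-· third (idft s)) ⟩
    w₀ ∷ map (w₀ +F_) (third ·Fⁿ dft (idft s))    ≡⟨ cong (λ t → w₀ ∷ map (w₀ +F_) (third ·Fⁿ t)) (dft-idft s) ⟩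
    w₀ ∷ map (w₀ +F_) (third ·Fⁿ (three ·Fⁿ s))   ≡⟨ cong (λ t → w₀ ∷ map (w₀ +F_) t) (map-cancel (third *F_) (three *F_) (third-cancels-three p%3≡1) s) ⟩
    w₀ ∷ map (w₀ +F_) (map (_-F w₀) w)            ≡⟨ cong (w₀ ∷_) (map-cancel (w₀ +F_) (_-F w₀) (λ x → trans (+F-comm w₀ (x -F w₀)) (-F-+F x w₀)) w) ⟩
    w₀ ∷ w                                        ∎
    where
    open ≡-Reasoning
    s = map (_-F w₀) w

  Φ-Ψ₁ : ∀ r → Φ (Ψ₁ r) ≡ r
  Φ-Ψ₁ ⟨ a , b , c , d ⟩ = begin
    Φ (Ψ₁ (toR a v))                                        ≡⟨ cong Φ (Ψ₁-toR a v) ⟩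
    toR a (third ·Fⁿ idft (map (_-F a) (map (a +F_) (dft v))))
      ≡⟨ cong (λ t → toR a (third ·Fⁿ idft t)) (map-cancel (_-F a) (a +F_) (λ x → trans (cong (_-F a) (+F-comm a x)) (+F--F x a)) (dft v)) ⟩
    toR a (third ·Fⁿ idft (dft v))                          ≡⟨ cong (λ t → toR a (third ·Fⁿ t)) (idft-dft v) ⟩
    toR a (third ·Fⁿ (three ·Fⁿ v))                         ≡⟨ cong (toR a) (map-cancel (third *F_) (three *F_) (third-cancels-three p%3≡1) v) ⟩
    toR a v                                                 ∎
    where
    open ≡-Reasoning
    v = b ∷ c ∷ d ∷ []

  Ψ₁-injective : ∀ {r s} → Ψ₁ r ≡ Ψ₁ s → r ≡ s
  Ψ₁-injective {r} {s} eq = trans (sym (Φ-Ψ₁ r)) (trans (cong Φ eq) (Φ-Ψ₁ s))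

  Ψ-+Rⁿ : ∀ {n} (x y : Vec R n) → Ψ (x +Rⁿ y) ≡ Ψ x +Fⁿ Ψ y
  Ψ-+Rⁿ [] [] = refl
  Ψ-+Rⁿ (r ∷ x) (s ∷ y) =
    trans (cong₂ _++_ (Ψ₁-+R r s) (Ψ-+Rⁿ x y)) (sym (zipWith-++ _+F_ (Ψ₁ r) (Ψ x) (Ψ₁ s) (Ψ y)))

  Ψ-·Rⁿ : ∀ {n} k (x : Vec R n) → Ψ (k ·Rⁿ x) ≡ k ·Fⁿ Ψ x
  Ψ-·Rⁿ k [] = refl
  Ψ-·Rⁿ k (r ∷ x) = trans (cong₂ _++_ (Ψ₁-·R k r) (Ψ-·Rⁿ k x)) (sym (map-++ (k *F_) (Ψ₁ r) (Ψ x)))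

  Ψ-replicate : ∀ n → Ψ (replicate n 0R) ≡ replicate (n * 4) 0F
  Ψ-replicate zero = refl
  Ψ-replicate (suc n) = cong₂ _++_ Ψ₁-0R (Ψ-replicate n)

  Ψ-injective : ∀ {n} (x y : Vec R n) → Ψ x ≡ Ψ y → x ≡ y
  Ψ-injective [] [] _ = refl
  Ψ-injective (r ∷ x) (s ∷ y) eq with ++-injective (Ψ₁ r) (Ψ₁ s) eq
  ... | Ψ₁r≡Ψ₁s , Ψx≡Ψy = cong₂ _∷_ (Ψ₁-injective Ψ₁r≡Ψ₁s) (Ψ-injective x y Ψx≡Ψy)

  Ψ-surjective : ∀ n (z : Vec F (n * 4)) → ∃ λ (x : Vec R n) → Ψ x ≡ z
  Ψ-surjective zero [] = [] , refl
  Ψ-surjective (suc n) (w₀ ∷ w₁ ∷ w₂ ∷ w₃ ∷ z) with Ψ-surjective n z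
  ... | x , Ψx≡z = Φ (w₀ ∷ w₁ ∷ w₂ ∷ w₃ ∷ []) ∷ x , cong₂ _++_ (Ψ₁-Φ (w₀ ∷ w₁ ∷ w₂ ∷ w₃ ∷ [])) Ψx≡z

  -- Isometry: Ψ x = Ψ (x − y) + Ψ y, and Hamming distance is translation invariant.
  Ψ-isometry : ∀ {n} (x y : Vec R n) → hammingDist (Ψ x) (Ψ y) ≡ grayDist x y
  Ψ-isometry x y = begin
    hammingDist (Ψ x) (Ψ y)                       ≡⟨ cong (λ t → hammingDist (Ψ t) (Ψ y)) (-Rⁿ-+Rⁿ x y) ⟨
    hammingDist (Ψ ((x -Rⁿ y) +Rⁿ y)) (Ψ y)       ≡⟨ cong (λ t → hammingDist t (Ψ y)) (Ψ-+Rⁿ (x -Rⁿ y) y) ⟩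
    hammingDist (Ψ (x -Rⁿ y) +Fⁿ Ψ y) (Ψ y)       ≡⟨ hammingDist-translate (Ψ (x -Rⁿ y)) (Ψ y) ⟩
    grayDist x y                                  ∎
    where open ≡-Reasoning

  -- ⟨Ψ x, Ψ (e·y)⟩ = ⟨Ψ₁ e, Ψ₁ ⟨x, y⟩_R⟩: on each block this is the symmetry of
  -- Σ uᵢvᵢwᵢ, because Ψ₁ is multiplicative.
  dot-Ψ-scaled : ∀ {n} e (x y : Vec R n) → dotF (Ψ x) (Ψ (e *Rⁿ y)) ≡ dotF (Ψ₁ e) (Ψ₁ (dotR x y))
  dot-Ψ-scaled e [] [] = sym (trans (cong (dotF (Ψ₁ e)) Ψ₁-0R) (dot-zeroʳ (Ψ₁ e)))
  dot-Ψ-scaled e (r ∷ x) (s ∷ y) = begin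
    dotF (Ψ₁ r ++ Ψ x) (Ψ₁ (e *R s) ++ Ψ (e *Rⁿ y))
      ≡⟨ dot-++ (Ψ₁ r) (Ψ₁ (e *R s)) (Ψ x) (Ψ (e *Rⁿ y)) ⟩
    dotF (Ψ₁ r) (Ψ₁ (e *R s)) +F dotF (Ψ x) (Ψ (e *Rⁿ y))
      ≡⟨ cong₂ _+F_ block (dot-Ψ-scaled e x y) ⟩
    dotF (Ψ₁ e) (Ψ₁ (r *R s)) +F dotF (Ψ₁ e) (Ψ₁ (dotR x y))
      ≡⟨ dot-+ʳ (Ψ₁ e) (Ψ₁ (r *R s)) (Ψ₁ (dotR x y)) ⟨
    dotF (Ψ₁ e) (Ψ₁ (r *R s) +Fⁿ Ψ₁ (dotR x y))
      ≡⟨ cong (dotF (Ψ₁ e)) (Ψ₁-+R (r *R s) (dotR x y)) ⟨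
    dotF (Ψ₁ e) (Ψ₁ (r *R s +R dotR x y)) ∎
    where
    open ≡-Reasoning
    block : dotF (Ψ₁ r) (Ψ₁ (e *R s)) ≡ dotF (Ψ₁ e) (Ψ₁ (r *R s))
    block = begin
      dotF (Ψ₁ r) (Ψ₁ (e *R s))    ≡⟨ cong (dotF (Ψ₁ r)) (Ψ₁-*R e s) ⟩
      dotF (Ψ₁ r) (Ψ₁ e ⊙ Ψ₁ s)    ≡⟨ dot-⊙-swap (Ψ₁ r) (Ψ₁ e) (Ψ₁ s) ⟩
      dotF (Ψ₁ e) (Ψ₁ r ⊙ Ψ₁ s)    ≡⟨ cong (dotF (Ψ₁ e)) (Ψ₁-*R r s) ⟨
      dotF (Ψ₁ e) (Ψ₁ (r *R s))    ∎

  ⊥R⇒⊥Ψ : ∀ {n} (x y : Vec R n) → dotR x y ≡ 0R → ∀ e → dotF (Ψ x) (Ψ (e *Rⁿ y)) ≡ 0F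
  ⊥R⇒⊥Ψ x y x⊥y e = begin
    dotF (Ψ x) (Ψ (e *Rⁿ y))        ≡⟨ dot-Ψ-scaled e x y ⟩
    dotF (Ψ₁ e) (Ψ₁ (dotR x y))     ≡⟨ cong (λ t → dotF (Ψ₁ e) (Ψ₁ t)) x⊥y ⟩
    dotF (Ψ₁ e) (Ψ₁ 0R)             ≡⟨ cong (dotF (Ψ₁ e)) Ψ₁-0R ⟩
    dotF (Ψ₁ e) (replicate 4 0F)    ≡⟨ dot-zeroʳ (Ψ₁ e) ⟩
    0F                              ∎
    where open ≡-Reasoning

  -- Conversely, since Ψ₁ is onto, Ψ₁ ⟨x, y⟩_R is orthogonal to all of F_p⁴.
  ⊥Ψ⇒⊥R : ∀ {n} (x y : Vec R n) → (∀ e → dotF (Ψ x) (Ψ (e *Rⁿ y)) ≡ 0F) → dotR x y ≡ 0R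
  ⊥Ψ⇒⊥R x y ⊥Ψ = Ψ₁-injective (trans (dot-nondegenerate (Ψ₁ (dotR x y)) ⊥all) (sym Ψ₁-0R))
    where
    ⊥all : ∀ w → dotF w (Ψ₁ (dotR x y)) ≡ 0F
    ⊥all w = begin
      dotF w (Ψ₁ (dotR x y))            ≡⟨ cong (λ t → dotF t (Ψ₁ (dotR x y))) (Ψ₁-Φ w) ⟨
      dotF (Ψ₁ (Φ w)) (Ψ₁ (dotR x y))   ≡⟨ dot-Ψ-scaled (Φ w) x y ⟨
      dotF (Ψ x) (Ψ (Φ w *Rⁿ y))        ≡⟨ ⊥Ψ (Φ w) ⟩
      0F                                ∎
      where open ≡-Reasoning

  image-code : ∀ {n} (C : Vec R n → Set) → IsRCode C → IsFCode (image C)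
  image-code {n} C (0∈C , +-closed , *-closed) =
      (replicate n 0R , 0∈C , Ψ-replicate n)
    , (λ { _ _ (x , x∈C , refl) (y , y∈C , refl) → x +Rⁿ y , +-closed x y x∈C y∈C , Ψ-+Rⁿ x y })
    , (λ { k _ (x , x∈C , refl) → k ·Rⁿ x , subst C (constR-*Rⁿ k x) (*-closed (constR k) x x∈C) , Ψ-·Rⁿ k x })

  Ψ-self-dual : ∀ {n} (C : Vec R n → Set) → IsSelfDualR C → IsSelfDualF (image C)
  Ψ-self-dual {n} C (C-code , C-self-dual) = image-code C C-code , λ z → image⇒dual z , dual⇒image z
    where
    *-closed : ∀ r x → C x → C (r *Rⁿ x)
    *-closed = proj₂ (proj₂ C-code)

    image⇒dual : ∀ z → image C z → DualF (image C) z
    image⇒dual _ (x , x∈C , refl) _ (y , y∈C , refl) = begin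
      dotF (Ψ x) (Ψ y)                   ≡⟨ cong (λ t → dotF (Ψ x) (Ψ t)) (trans (constR-*Rⁿ 1F y) (·Rⁿ-identity y)) ⟨
      dotF (Ψ x) (Ψ (constR 1F *Rⁿ y))   ≡⟨ ⊥R⇒⊥Ψ x y (proj₁ (C-self-dual x) x∈C y y∈C) (constR 1F) ⟩
      0F                                 ∎
      where open ≡-Reasoning

    dual⇒image : ∀ z → DualF (image C) z → image C z
    dual⇒image z z⊥C with Ψ-surjective n z
    ... | x , refl = x , proj₂ (C-self-dual x) x⊥C , refl
      where
      x⊥C : DualR C x
      x⊥C y y∈C = ⊥Ψ⇒⊥R x y (λ e → z⊥C (Ψ (e *Rⁿ y)) (e *Rⁿ y , *-closed e y y∈C , refl))

theorem13 : (p : ℕ) .{{_ : NonZero p}} → Prime p → p % 3 ≡ 1 →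
    (ξ : Fp.F p) → Fp.PrimitiveCubeRoot p ξ → (n : ℕ) →
      ((∀ (x y : Vec (Fp.R p) n) → Fp.Gray.Ψ p ξ (Fp._+Rⁿ_ p x y) ≡ Fp._+Fⁿ_ p (Fp.Gray.Ψ p ξ x) (Fp.Gray.Ψ p ξ y))
        × (∀ (k : Fp.F p) (x : Vec (Fp.R p) n) → Fp.Gray.Ψ p ξ (Fp._·Rⁿ_ p k x) ≡ Fp._·Fⁿ_ p k (Fp.Gray.Ψ p ξ x))
        × (∀ (x y : Vec (Fp.R p) n) → Fp.Gray.Ψ p ξ x ≡ Fp.Gray.Ψ p ξ y → x ≡ y)
        × (∀ (z : Vec (Fp.F p) (n * 4)) → ∃ λ (x : Vec (Fp.R p) n) → Fp.Gray.Ψ p ξ x ≡ z))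
      × (∀ (C : Vec (Fp.R p) n → Set) → Fp.IsSelfDualR p C → Fp.IsSelfDualF p (Fp.Gray.image p ξ C))
      × (∀ (x y : Vec (Fp.R p) n) → Fp.hammingDist p (Fp.Gray.Ψ p ξ x) (Fp.Gray.Ψ p ξ y) ≡ Fp.Gray.grayDist p ξ x y)
theorem13 p p-prime p%3≡1 ξ ξ-primitive n =
    (Ψ-+Rⁿ , Ψ-·Rⁿ , Ψ-injective , Ψ-surjective n)
  , Ψ-self-dual
  , Ψ-isometry
  where open GrayMap p p-prime p%3≡1 ξ ξ-primitive
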